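{- For $n\in\mathbb{N}$, $$\sum_{k=0}^{n}\binom{2k}{k}\equiv\begin{cases}(-1)^{\delta_3(n)}\pmod 3&\text{if } n\in 3T(01),\\ 0\pmod 3&\text{otherwise.}\end{cases}$$
   Context: $\delta_3(n)$ denotes the number of digits equal to $1$ in the base-$3$ expansion of $n$. $T(01)$ denotes the set of $m\in\mathbb{N}$ whose base-$3$ expansion contains only digits $0$ and $1$, and $3T(01)=\{3m : m\in T(01)\}$. -}

module Defs where

open import Data.Nat using (ℕ; zero; suc; _+_; _*_; _^_; _≡ᵇ_)
open import Data.Nat.DivMod using (_/_; _%_)
open import Data.Nat.Combinatorics using (_C_)
open import Data.List using (List; []; _∷_; map; upTo; length; filter)
open import Data.Nat.ListAction using (sum)
open import Data.List.Relation.Unary.All using (All)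
open import Data.Product using (∃; _×_)
open import Data.Sum using (_⊎_)
open import Relation.Binary.PropositionalEquality using (_≡_)
open import Data.Nat.Properties using (_≟_)

-- base-3 digits of n, least significant first (empty list for n = 0).
-- The fuel argument f must be ≥ n (each step divides by 3, so fuel n suffices).
digits3-fuel : ℕ → ℕ → List ℕ
digits3-fuel zero    _       = []
digits3-fuel (suc f) zero    = []
digits3-fuel (suc f) (suc m) = (suc m % 3) ∷ digits3-fuel f (suc m / 3)

digits3 : ℕ → List ℕ
digits3 n = digits3-fuel n n

δ₃ : ℕ → ℕ
δ₃ n = length (filter (_≟ 1) (digits3 n))

T01 : ℕ → Set
T01 m = All (λ d → d ≡ 0 ⊎ d ≡ 1) (digits3 m)

In3T01 : ℕ → Set
In3T01 n = ∃ λ m → T01 m × n ≡ 3 * m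

centralBinomSum : ℕ → ℕ
centralBinomSum n = sum (map (λ k → (2 * k) C k) (upTo (suc n)))

-- Modulo 3, Lucas' theorem gives C(6a, 3a) ≡ C(2a, a), C(6a+2, 3a+1) ≡ -C(2a, a) and
-- C(6a+4, 3a+2) ≡ 0, so by induction on the base-3 digits C(2q, q) ≡ (-1)^δ₃(q) when q ∈ T(01)
-- and C(2q, q) ≡ 0 otherwise. For the partial sums S(n) = Σ_{k≤n} C(2k, k) this gives, by
-- induction on a, S(3a) ≡ C(2a, a) and S(3a+1) ≡ S(3a+2) ≡ 0.
module Submission where

open import Defs
open import Data.Nat using (ℕ)
open import Data.Product using (_×_)
open import Relation.Nullary using (¬_)
open import Data.Integer using (ℤ; +_; -_; _-_; _^_)
open import Data.Integer.Divisibility using (_∣_)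

open import Data.Nat as ℕ using (zero; suc; _+_; _*_; _<_; _≤_; _≟_; s≤s; z≤n)
open import Data.Nat.Properties using (*-suc; *-comm; m≤m+n; m<m+n; m<n⇒m<1+n; ≤-trans; ≤-refl; +-identityʳ)
open import Data.Nat.DivMod using (_/_; _%_; m/n<m; [m+kn]%n≡m%n; m<n⇒m%n≡m; m<n⇒m/n≡0; +-distrib-/-∣ʳ; m*n/n≡m)
open import Data.Nat.Divisibility using (m∣m*n)
open import Data.Nat.Combinatorics using (_C_; nCk+nC[k+1]≡[n+1]C[k+1])
open import Data.Nat.Induction using (<-rec)
open import Data.Nat.ListAction using (sum)
open import Data.Nat.ListAction.Properties using (sum-++)
open import Data.Nat.Tactic.RingSolver using (solve-∀)
open import Data.Integer.Divisibility using (divides)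
import Data.Integer.Properties as ℤ
open import Data.List using ([]; _∷_; _++_; map; upTo; length; filter)
open import Data.List.Properties using (applyUpTo-∷ʳ; map-++)
open import Data.List.Relation.Unary.All using (All; []; _∷_; head; tail)
open import Data.Product using (_,_)
open import Data.Sum using (_⊎_; inj₁; inj₂)
open import Function using (_∘_; const; id)
open import Relation.Nullary using (contradiction)
open import Relation.Binary.PropositionalEquality

data ℤ₃ : Set where
  0₃ 1₃ 2₃ : ℤ₃

suc₃ : ℤ₃ → ℤ₃
suc₃ 0₃ = 1₃
suc₃ 1₃ = 2₃
suc₃ 2₃ = 0₃

infixl 6 _+₃_
_+₃_ : ℤ₃ → ℤ₃ → ℤ₃
0₃ +₃ y = y
1₃ +₃ y = suc₃ y
2₃ +₃ y = suc₃ (suc₃ y)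

-₃_ : ℤ₃ → ℤ₃
-₃ 0₃ = 0₃
-₃ 1₃ = 2₃
-₃ 2₃ = 1₃

[_]₃ : ℕ → ℤ₃
[ zero ]₃  = 0₃
[ suc n ]₃ = suc₃ [ n ]₃

suc₃-+₃ : ∀ x y → suc₃ (x +₃ y) ≡ suc₃ x +₃ y
suc₃-+₃ 0₃ y  = refl
suc₃-+₃ 1₃ y  = refl
suc₃-+₃ 2₃ 0₃ = refl
suc₃-+₃ 2₃ 1₃ = refl
suc₃-+₃ 2₃ 2₃ = refl

+₃-identityʳ : ∀ x → x +₃ 0₃ ≡ x
+₃-identityʳ 0₃ = refl
+₃-identityʳ 1₃ = refl
+₃-identityʳ 2₃ = refl

+₃-inverseʳ : ∀ x → x +₃ -₃ x ≡ 0₃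
+₃-inverseʳ 0₃ = refl
+₃-inverseʳ 1₃ = refl
+₃-inverseʳ 2₃ = refl

+₃-inverseˡ : ∀ x → -₃ x +₃ x ≡ 0₃
+₃-inverseˡ 0₃ = refl
+₃-inverseˡ 1₃ = refl
+₃-inverseˡ 2₃ = refl

x+₃x≡-₃x : ∀ x → x +₃ x ≡ -₃ x
x+₃x≡-₃x 0₃ = refl
x+₃x≡-₃x 1₃ = refl
x+₃x≡-₃x 2₃ = refl

[]₃-+ : ∀ m n → [ m + n ]₃ ≡ [ m ]₃ +₃ [ n ]₃
[]₃-+ zero    n = refl
[]₃-+ (suc m) n = trans (cong suc₃ ([]₃-+ m n)) (suc₃-+₃ [ m ]₃ [ n ]₃)

[3*n]₃≡0₃ : ∀ n → [ 3 * n ]₃ ≡ 0₃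
[3*n]₃≡0₃ zero    = refl
[3*n]₃≡0₃ (suc n) = trans (cong [_]₃ (*-suc 3 n)) (cong (λ x → suc₃ (suc₃ (suc₃ x))) ([3*n]₃≡0₃ n))

alt₃ : ℕ → ℤ₃
alt₃ zero    = 1₃
alt₃ (suc k) = -₃ alt₃ k

-- Balanced representatives: 2₃ is sent to -1, so that toℤ (alt₃ k) is (-1)^k.
toℤ : ℤ₃ → ℤ
toℤ 0₃ = + 0
toℤ 1₃ = + 1
toℤ 2₃ = - + 1

toℤ-alt₃ : ∀ k → toℤ (alt₃ k) ≡ (- + 1) ^ k
toℤ-alt₃ zero    = refl
toℤ-alt₃ (suc k) = begin
  toℤ (-₃ alt₃ k)        ≡⟨ toℤ-neg (alt₃ k) ⟩
  - toℤ (alt₃ k)         ≡⟨ cong -_ (toℤ-alt₃ k) ⟩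
  - (- + 1) ^ k          ≡⟨ ℤ.-1*i≡-i _ ⟨
  (- + 1) ^ suc k        ∎
  where
  open ≡-Reasoning
  toℤ-neg : ∀ x → toℤ (-₃ x) ≡ - toℤ x
  toℤ-neg 0₃ = refl
  toℤ-neg 1₃ = refl
  toℤ-neg 2₃ = refl

binom₃ : ℕ → ℕ → ℤ₃
binom₃ n k = [ n C k ]₃

binom₃-pascal : ∀ n k → binom₃ (suc n) (suc k) ≡ binom₃ n k +₃ binom₃ n (suc k)
binom₃-pascal n k =
  trans (cong [_]₃ (sym (nCk+nC[k+1]≡[n+1]C[k+1] n k))) ([]₃-+ (n C k) (n C suc k))

-- Lucas' theorem mod 3 for the row n = r + 3a: C(n, s + 3k) ≡ C(r, s) C(a, k), with
-- cₛ being multiplication by C(r, s).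
record LucasRow (n a : ℕ) (c₀ c₁ c₂ : ℤ₃ → ℤ₃) : Set where
  field
    col₀ : ∀ k → binom₃ n (3 * k) ≡ c₀ (binom₃ a k)
    col₁ : ∀ k → binom₃ n (1 + 3 * k) ≡ c₁ (binom₃ a k)
    col₂ : ∀ k → binom₃ n (2 + 3 * k) ≡ c₂ (binom₃ a k)

open LucasRow

module _ {n a c₀ c₁ c₂} (row : LucasRow n a c₀ c₁ c₂) where

  next-col₀ : ∀ k → binom₃ (suc n) (3 * suc k) ≡ c₂ (binom₃ a k) +₃ c₀ (binom₃ a (suc k))
  next-col₀ k = begin
    binom₃ (suc n) (3 * suc k)                    ≡⟨ cong (binom₃ (suc n)) (*-suc 3 k) ⟩
    binom₃ (suc n) (3 + 3 * k)                    ≡⟨ binom₃-pascal n (2 + 3 * k) ⟩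
    binom₃ n (2 + 3 * k) +₃ binom₃ n (3 + 3 * k)  ≡⟨ cong (λ j → binom₃ n (2 + 3 * k) +₃ binom₃ n j) (*-suc 3 k) ⟨
    binom₃ n (2 + 3 * k) +₃ binom₃ n (3 * suc k)  ≡⟨ cong₂ _+₃_ (col₂ row k) (col₀ row (suc k)) ⟩
    c₂ (binom₃ a k) +₃ c₀ (binom₃ a (suc k))      ∎
    where open ≡-Reasoning

  next-col₁ : ∀ k → binom₃ (suc n) (1 + 3 * k) ≡ c₀ (binom₃ a k) +₃ c₁ (binom₃ a k)
  next-col₁ k = trans (binom₃-pascal n (3 * k)) (cong₂ _+₃_ (col₀ row k) (col₁ row k))

  next-col₂ : ∀ k → binom₃ (suc n) (2 + 3 * k) ≡ c₁ (binom₃ a k) +₃ c₂ (binom₃ a k)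
  next-col₂ k = trans (binom₃-pascal n (1 + 3 * k)) (cong₂ _+₃_ (col₁ row k) (col₂ row k))

LucasRow₀ LucasRow₁ LucasRow₂ : ℕ → Set
LucasRow₀ a = LucasRow (3 * a) a id (const 0₃) (const 0₃)
LucasRow₁ a = LucasRow (1 + 3 * a) a id id (const 0₃)
LucasRow₂ a = LucasRow (2 + 3 * a) a id -₃_ id

lucasRow₀⇒lucasRow₁ : ∀ {a} → LucasRow₀ a → LucasRow₁ a
lucasRow₀⇒lucasRow₁ row .col₀ zero    = refl
lucasRow₀⇒lucasRow₁ row .col₀ (suc k) = next-col₀ row k
lucasRow₀⇒lucasRow₁ row .col₁ k       = trans (next-col₁ row k) (+₃-identityʳ _)
lucasRow₀⇒lucasRow₁ row .col₂ k       = next-col₂ row k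

lucasRow₁⇒lucasRow₂ : ∀ {a} → LucasRow₁ a → LucasRow₂ a
lucasRow₁⇒lucasRow₂ row .col₀ zero    = refl
lucasRow₁⇒lucasRow₂ row .col₀ (suc k) = next-col₀ row k
lucasRow₁⇒lucasRow₂ row .col₁ k       = trans (next-col₁ row k) (x+₃x≡-₃x _)
lucasRow₁⇒lucasRow₂ row .col₂ k       = trans (next-col₂ row k) (+₃-identityʳ _)

-- The carry into the next row of Pascal's triangle mod 3 is Pascal's rule for C(a, k).
lucasRow₂⇒lucasRow₀ : ∀ {a} → LucasRow₂ a → LucasRow₀ (suc a)
lucasRow₂⇒lucasRow₀ {a} row =
  subst (λ n → LucasRow n (suc a) id (const 0₃) (const 0₃)) (sym (*-suc 3 a)) row′
  where
  row′ : LucasRow (3 + 3 * a) (suc a) id (const 0₃) (const 0₃)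
  row′ .col₀ zero    = refl
  row′ .col₀ (suc k) = trans (next-col₀ row k) (sym (binom₃-pascal a k))
  row′ .col₁ k       = trans (next-col₁ row k) (+₃-inverseʳ (binom₃ a k))
  row′ .col₂ k       = trans (next-col₂ row k) (+₃-inverseˡ (binom₃ a k))

lucasRow₀ : ∀ a → LucasRow₀ a
lucasRow₀ zero    .col₀ zero    = refl
lucasRow₀ zero    .col₀ (suc k) = refl
lucasRow₀ zero    .col₁ k       = refl
lucasRow₀ zero    .col₂ k       = refl
lucasRow₀ (suc a) = lucasRow₂⇒lucasRow₀ (lucasRow₁⇒lucasRow₂ (lucasRow₀⇒lucasRow₁ (lucasRow₀ a)))

lucasRow₁ : ∀ a → LucasRow₁ a
lucasRow₁ a = lucasRow₀⇒lucasRow₁ (lucasRow₀ a)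

lucasRow₂ : ∀ a → LucasRow₂ a
lucasRow₂ a = lucasRow₁⇒lucasRow₂ (lucasRow₁ a)

central₃ : ℕ → ℤ₃
central₃ n = binom₃ (2 * n) n

central₃-3* : ∀ q → central₃ (3 * q) ≡ central₃ q
central₃-3* q = trans (cong (λ n → binom₃ n (3 * q)) (2*[3*q]≡3*[2*q] q)) (col₀ (lucasRow₀ (2 * q)) q)
  where
  2*[3*q]≡3*[2*q] : ∀ q → 2 * (3 * q) ≡ 3 * (2 * q)
  2*[3*q]≡3*[2*q] = solve-∀

central₃-1+3* : ∀ q → central₃ (1 + 3 * q) ≡ -₃ central₃ q
central₃-1+3* q = trans (cong (λ n → binom₃ n (1 + 3 * q)) (2*[1+3*q]≡2+3*[2*q] q)) (col₁ (lucasRow₂ (2 * q)) q)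
  where
  2*[1+3*q]≡2+3*[2*q] : ∀ q → 2 * (1 + 3 * q) ≡ 2 + 3 * (2 * q)
  2*[1+3*q]≡2+3*[2*q] = solve-∀

central₃-2+3* : ∀ q → central₃ (2 + 3 * q) ≡ 0₃
central₃-2+3* q = trans (cong (λ n → binom₃ n (2 + 3 * q)) (2*[2+3*q]≡1+3*[1+2*q] q)) (col₂ (lucasRow₁ (1 + 2 * q)) q)
  where
  2*[2+3*q]≡1+3*[1+2*q] : ∀ q → 2 * (2 + 3 * q) ≡ 1 + 3 * (1 + 2 * q)
  2*[2+3*q]≡1+3*[1+2*q] = solve-∀

centralBinomSum-suc : ∀ n → centralBinomSum (suc n) ≡ centralBinomSum n + (2 * suc n) C suc n
centralBinomSum-suc n = begin
  sum (map f (upTo (2 + n)))                     ≡⟨ cong (sum ∘ map f) (applyUpTo-∷ʳ id (suc n)) ⟨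
  sum (map f (upTo (suc n) ++ suc n ∷ []))        ≡⟨ cong sum (map-++ f (upTo (suc n)) (suc n ∷ [])) ⟩
  sum (map f (upTo (suc n)) ++ f (suc n) ∷ [])    ≡⟨ sum-++ (map f (upTo (suc n))) (f (suc n) ∷ []) ⟩
  centralBinomSum n + (f (suc n) + 0)             ≡⟨ cong (λ x → centralBinomSum n + x) (+-identityʳ (f (suc n))) ⟩
  centralBinomSum n + f (suc n)                   ∎
  where
  open ≡-Reasoning
  f : ℕ → ℕ
  f k = (2 * k) C k

sum₃ : ℕ → ℤ₃
sum₃ n = [ centralBinomSum n ]₃

sum₃-suc : ∀ n → sum₃ (suc n) ≡ sum₃ n +₃ central₃ (suc n)
sum₃-suc n = trans (cong [_]₃ (centralBinomSum-suc n)) ([]₃-+ (centralBinomSum n) _)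

sum₃-3*     : ∀ q → sum₃ (3 * q) ≡ central₃ q
sum₃-1+3*   : ∀ q → sum₃ (1 + 3 * q) ≡ 0₃
sum₃-2+3*   : ∀ q → sum₃ (2 + 3 * q) ≡ 0₃

sum₃-3* zero    = refl
sum₃-3* (suc q) = begin
  sum₃ (3 * suc q)                          ≡⟨ cong sum₃ (*-suc 3 q) ⟩
  sum₃ (3 + 3 * q)                          ≡⟨ sum₃-suc (2 + 3 * q) ⟩
  sum₃ (2 + 3 * q) +₃ central₃ (3 + 3 * q)  ≡⟨ cong₂ _+₃_ (sum₃-2+3* q) (cong central₃ (sym (*-suc 3 q))) ⟩
  central₃ (3 * suc q)                      ≡⟨ central₃-3* (suc q) ⟩
  central₃ (suc q)                          ∎
  where open ≡-Reasoning

sum₃-1+3* q = begin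
  sum₃ (1 + 3 * q)                      ≡⟨ sum₃-suc (3 * q) ⟩
  sum₃ (3 * q) +₃ central₃ (1 + 3 * q)  ≡⟨ cong₂ _+₃_ (sum₃-3* q) (central₃-1+3* q) ⟩
  central₃ q +₃ -₃ central₃ q           ≡⟨ +₃-inverseʳ (central₃ q) ⟩
  0₃                                     ∎
  where open ≡-Reasoning

sum₃-2+3* q = trans (sum₃-suc (1 + 3 * q)) (cong₂ _+₃_ (sum₃-1+3* q) (central₃-2+3* q))

data Residue₃ : ℕ → Set where
  0+3* : ∀ a → Residue₃ (3 * a)
  1+3* : ∀ a → Residue₃ (1 + 3 * a)
  2+3* : ∀ a → Residue₃ (2 + 3 * a)

residue₃ : ∀ n → Residue₃ n
residue₃ zero = 0+3* 0
residue₃ (suc n) with residue₃ n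
... | 0+3* a = 1+3* a
... | 1+3* a = 2+3* a
... | 2+3* a = subst Residue₃ (*-suc 3 a) (0+3* (suc a))

base₃-induction : (P : ℕ → Set) → P 0 →
                  (∀ a → P a → P (3 * a)) →
                  (∀ a → P a → P (1 + 3 * a)) →
                  (∀ a → P a → P (2 + 3 * a)) →
                  ∀ n → P n
base₃-induction P P0 step₀ step₁ step₂ = <-rec P go
  where
  go : ∀ n → (∀ {m} → m < n → P m) → P n
  go n rec with residue₃ n
  ... | 0+3* zero    = P0
  ... | 0+3* (suc a) = step₀ (suc a) (rec (m<m+n (suc a) (s≤s z≤n)))
  ... | 1+3* a       = step₁ a (rec (s≤s (m≤m+n a (2 * a))))
  ... | 2+3* a       = step₂ a (rec (m<n⇒m<1+n (s≤s (m≤m+n a (2 * a)))))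

suc[m]/3≤m : ∀ m → suc m / 3 ≤ m
suc[m]/3≤m m = ℕ.≤-pred (m/n<m (suc m) 3 (s≤s (s≤s z≤n)))

digits3-fuel-irrelevant : ∀ {f g n} → n ≤ f → n ≤ g → digits3-fuel f n ≡ digits3-fuel g n
digits3-fuel-irrelevant {zero}  {zero}  {zero}  _         _         = refl
digits3-fuel-irrelevant {zero}  {suc g} {zero}  _         _         = refl
digits3-fuel-irrelevant {suc f} {zero}  {zero}  _         _         = refl
digits3-fuel-irrelevant {suc f} {suc g} {zero}  _         _         = refl
digits3-fuel-irrelevant {suc f} {suc g} {suc m} (s≤s m≤f) (s≤s m≤g) =
  cong (suc m % 3 ∷_) (digits3-fuel-irrelevant (≤-trans (suc[m]/3≤m m) m≤f) (≤-trans (suc[m]/3≤m m) m≤g))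

digits3-pos : ∀ {n} → 0 < n → digits3 n ≡ n % 3 ∷ digits3 (n / 3)
digits3-pos {suc m} _ = cong (suc m % 3 ∷_) (digits3-fuel-irrelevant (suc[m]/3≤m m) ≤-refl)

digits3-r+3* : ∀ {r} a → r < 3 → 0 < r + 3 * a → digits3 (r + 3 * a) ≡ r ∷ digits3 a
digits3-r+3* {r} a r<3 pos = trans (digits3-pos pos) (cong₂ (λ d q → d ∷ digits3 q) [r+3a]%3≡r [r+3a]/3≡a)
  where
  open ≡-Reasoning
  [r+3a]%3≡r : (r + 3 * a) % 3 ≡ r
  [r+3a]%3≡r = begin
    (r + 3 * a) % 3  ≡⟨ cong (λ x → (r + x) % 3) (*-comm 3 a) ⟩
    (r + a * 3) % 3  ≡⟨ [m+kn]%n≡m%n r a 3 ⟩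
    r % 3            ≡⟨ m<n⇒m%n≡m r<3 ⟩
    r                ∎
  [r+3a]/3≡a : (r + 3 * a) / 3 ≡ a
  [r+3a]/3≡a = begin
    (r + 3 * a) / 3    ≡⟨ +-distrib-/-∣ʳ r (m∣m*n a) ⟩
    r / 3 + 3 * a / 3  ≡⟨ cong₂ _+_ (m<n⇒m/n≡0 r<3) (trans (cong (_/ 3) (*-comm 3 a)) (m*n/n≡m a 3)) ⟩
    a                  ∎

digits3-3*suc : ∀ a → digits3 (3 * suc a) ≡ 0 ∷ digits3 (suc a)
digits3-3*suc a = digits3-r+3* (suc a) (s≤s z≤n) (s≤s z≤n)

digits3-1+3* : ∀ a → digits3 (1 + 3 * a) ≡ 1 ∷ digits3 a
digits3-1+3* a = digits3-r+3* a (s≤s (s≤s z≤n)) (s≤s z≤n)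

digits3-2+3* : ∀ a → digits3 (2 + 3 * a) ≡ 2 ∷ digits3 a
digits3-2+3* a = digits3-r+3* a (s≤s (s≤s (s≤s z≤n))) (s≤s z≤n)

Digit01 : ℕ → Set
Digit01 d = d ≡ 0 ⊎ d ≡ 1

module _ {n d a} (digits≡ : digits3 n ≡ d ∷ digits3 a) where

  T01-head : T01 n → Digit01 d
  T01-head t = head (subst (All Digit01) digits≡ t)

  T01-tail : T01 n → T01 a
  T01-tail t = tail (subst (All Digit01) digits≡ t)

  T01-cons : Digit01 d → T01 a → T01 n
  T01-cons d01 t = subst (All Digit01) (sym digits≡) (d01 ∷ t)

  δ₃-cons : δ₃ n ≡ length (filter (_≟ 1) (d ∷ digits3 a))
  δ₃-cons = cong (λ ds → length (filter (_≟ 1) ds)) digits≡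

T01[3a]⇒T01[a] : ∀ a → T01 (3 * a) → T01 a
T01[3a]⇒T01[a] zero    t = t
T01[3a]⇒T01[a] (suc a) = T01-tail (digits3-3*suc a)

T01[a]⇒T01[3a] : ∀ a → T01 a → T01 (3 * a)
T01[a]⇒T01[3a] zero    t = t
T01[a]⇒T01[3a] (suc a) = T01-cons (digits3-3*suc a) (inj₁ refl)

T01[1+3a]⇒T01[a] : ∀ a → T01 (1 + 3 * a) → T01 a
T01[1+3a]⇒T01[a] a = T01-tail (digits3-1+3* a)

T01[a]⇒T01[1+3a] : ∀ a → T01 a → T01 (1 + 3 * a)
T01[a]⇒T01[1+3a] a = T01-cons (digits3-1+3* a) (inj₂ refl)

¬T01[2+3a] : ∀ a → ¬ T01 (2 + 3 * a)
¬T01[2+3a] a t with T01-head (digits3-2+3* a) t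
... | inj₁ ()
... | inj₂ ()

δ₃-3* : ∀ a → δ₃ (3 * a) ≡ δ₃ a
δ₃-3* zero    = refl
δ₃-3* (suc a) = δ₃-cons (digits3-3*suc a)

δ₃-1+3* : ∀ a → δ₃ (1 + 3 * a) ≡ suc (δ₃ a)
δ₃-1+3* a = δ₃-cons (digits3-1+3* a)

central₃-T01 : ∀ q → T01 q → central₃ q ≡ alt₃ (δ₃ q)
central₃-T01 = base₃-induction P (λ _ → refl) step₀ step₁ step₂
  where
  open ≡-Reasoning
  P : ℕ → Set
  P q = T01 q → central₃ q ≡ alt₃ (δ₃ q)
  step₀ : ∀ a → P a → P (3 * a)
  step₀ a ih t = begin
    central₃ (3 * a)      ≡⟨ central₃-3* a ⟩
    central₃ a            ≡⟨ ih (T01[3a]⇒T01[a] a t) ⟩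
    alt₃ (δ₃ a)           ≡⟨ cong alt₃ (δ₃-3* a) ⟨
    alt₃ (δ₃ (3 * a))     ∎
  step₁ : ∀ a → P a → P (1 + 3 * a)
  step₁ a ih t = begin
    central₃ (1 + 3 * a)  ≡⟨ central₃-1+3* a ⟩
    -₃ central₃ a         ≡⟨ cong -₃_ (ih (T01[1+3a]⇒T01[a] a t)) ⟩
    alt₃ (suc (δ₃ a))     ≡⟨ cong alt₃ (δ₃-1+3* a) ⟨
    alt₃ (δ₃ (1 + 3 * a)) ∎
  step₂ : ∀ a → P a → P (2 + 3 * a)
  step₂ a _ t = contradiction t (¬T01[2+3a] a)

central₃-¬T01 : ∀ q → ¬ T01 q → central₃ q ≡ 0₃
central₃-¬T01 = base₃-induction P (λ ¬t → contradiction [] ¬t) step₀ step₁ step₂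
  where
  P : ℕ → Set
  P q = ¬ T01 q → central₃ q ≡ 0₃
  step₀ : ∀ a → P a → P (3 * a)
  step₀ a ih ¬t = trans (central₃-3* a) (ih (¬t ∘ T01[a]⇒T01[3a] a))
  step₁ : ∀ a → P a → P (1 + 3 * a)
  step₁ a ih ¬t = trans (central₃-1+3* a) (cong -₃_ (ih (¬t ∘ T01[a]⇒T01[1+3a] a)))
  step₂ : ∀ a → P a → P (2 + 3 * a)
  step₂ a _ _ = central₃-2+3* a

sum₃-¬In3T01 : ∀ n → ¬ In3T01 n → sum₃ n ≡ 0₃
sum₃-¬In3T01 n ¬in with residue₃ n
... | 0+3* a = trans (sum₃-3* a) (central₃-¬T01 a (λ t → ¬in (a , t , refl)))
... | 1+3* a = sum₃-1+3* a
... | 2+3* a = sum₃-2+3* a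

3∣n-toℤ[n]₃ : ∀ n → + 3 ∣ + n - toℤ [ n ]₃
3∣n-toℤ[n]₃ n with residue₃ n
... | 0+3* a rewrite [3*n]₃≡0₃ a = divides a (3*a+0≡a*3 a)
  where
  3*a+0≡a*3 : ∀ a → 3 * a + 0 ≡ a * 3
  3*a+0≡a*3 = solve-∀
... | 1+3* a rewrite [3*n]₃≡0₃ a = divides a (*-comm 3 a)
... | 2+3* a rewrite [3*n]₃≡0₃ a = divides (suc a) (2+3*a+1≡[1+a]*3 a)
  where
  2+3*a+1≡[1+a]*3 : ∀ a → 2 + 3 * a + 1 ≡ suc a * 3
  2+3*a+1≡[1+a]*3 = solve-∀

[n]₃≡alt₃⇒3∣n-[-1]^k : ∀ n k → [ n ]₃ ≡ alt₃ k → + 3 ∣ + n - (- + 1) ^ k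
[n]₃≡alt₃⇒3∣n-[-1]^k n k eq =
  subst (λ i → + 3 ∣ + n - i) (trans (cong toℤ eq) (toℤ-alt₃ k)) (3∣n-toℤ[n]₃ n)

[n]₃≡0₃⇒3∣n : ∀ n → [ n ]₃ ≡ 0₃ → + 3 ∣ + n
[n]₃≡0₃⇒3∣n n eq =
  subst (+ 3 ∣_) (ℤ.+-identityʳ (+ n)) (subst (λ x → + 3 ∣ + n - toℤ x) eq (3∣n-toℤ[n]₃ n))

theorem5p6 : (n : ℕ) →
    (In3T01 n → + 3 ∣ (+ centralBinomSum n - (- + 1) ^ δ₃ n))
    × (¬ In3T01 n → + 3 ∣ + centralBinomSum n)
theorem5p6 n = in3T01⇒ , [n]₃≡0₃⇒3∣n (centralBinomSum n) ∘ sum₃-¬In3T01 n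
  where
  open ≡-Reasoning
  in3T01⇒ : In3T01 n → + 3 ∣ (+ centralBinomSum n - (- + 1) ^ δ₃ n)
  in3T01⇒ (m , t , refl) = [n]₃≡alt₃⇒3∣n-[-1]^k (centralBinomSum (3 * m)) (δ₃ (3 * m)) (begin
    sum₃ (3 * m)          ≡⟨ sum₃-3* m ⟩
    central₃ m            ≡⟨ central₃-T01 m t ⟩
    alt₃ (δ₃ m)           ≡⟨ cong alt₃ (δ₃-3* m) ⟨
    alt₃ (δ₃ (3 * m))     ∎)
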